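{- Let $(a_n)_{n\ge1}$ be a sequence of positive integers, $n\ge1$, and let $x_0,x_n$ be integers with $2^{b_n}x_n-3^nx_0=B_n$, $1\le x_0<2^{b_n}$, $1\le x_n<3^n$. Define $x_k=\frac{3x_{k-1}+1}{2^{a_k}}$ for $1\le k\le n-1$, and suppose $x_i\ne x_j$ for all $0\le i<j\le n-1$. Then: (i) $\frac{B_n}{3^n}>\frac n3$ implies $x_k\le x_0$ for some $1\le k\le n-1$; (ii) $\frac{B_n}{3^n}<\frac n3$ implies $x_0\le x_k$ for some $1\le k\le n$; (iii) $\frac{B_n}{2^{b_n}}\le\frac n3$ implies $x_n\le x_i$ for some $0\le i\le n-1$; (iv) $\frac{B_n}{2^{b_n}}\ge\frac n3$ implies $x_n\ge x_k$ for some $0\le k\le n-1$.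
   Context: For a sequence $(a_n)_{n\ge1}$ of positive integers: $b_0=0$, $b_n=\sum_{i=1}^n a_i$, and $B_n=\sum_{i=0}^{n-1}3^{n-1-i}2^{b_i}$. -}

module Defs where

open import Data.Nat using (ℕ; NonZero; zero; suc; _∸_; _^_) renaming (_+_ to _+ℕ_; _*_ to _*ℕ_)
open import Data.Nat.Properties using (m^n≢0)
open import Data.Integer using (ℤ; +_)
open import Data.Rational using (ℚ; _/_; 1ℚ) renaming (_+_ to _+ℚ_; _*_ to _*ℚ_)

sumTo : ℕ → (ℕ → ℕ) → ℕ
sumTo zero    f = 0
sumTo (suc n) f = sumTo n f +ℕ f n

-- the sequence (a_n)_{n ≥ 1} is a function a : ℕ → ℕ; the value a 0 is never used.
-- b_0 = 0, b_n = Σ_{i=1}^n a_i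
b : (ℕ → ℕ) → ℕ → ℕ
b a n = sumTo n (λ i → a (suc i))

B : (ℕ → ℕ) → ℕ → ℕ
B a n = sumTo n (λ i → 3 ^ (n ∸ 1 ∸ i) *ℕ 2 ^ (b a i))

ℤtoℚ : ℤ → ℚ
ℤtoℚ z = z / 1

ℕtoℚ : ℕ → ℚ
ℕtoℚ m = (+ m) / 1

_/pow_^_ : ℕ → (k : ℕ) → .{{_ : NonZero k}} → ℕ → ℚ
m /pow k ^ e = _/_ (+ m) (k ^ e) {{m^n≢0 k e}}

xs : (ℕ → ℕ) → ℤ → ℕ → ℚ
xs a x0 zero    = ℤtoℚ x0
xs a x0 (suc k) = (ℕtoℚ 3 *ℚ xs a x0 k +ℚ 1ℚ) *ℚ (1 /pow 2 ^ a (suc k))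

module Submission where

-- With Y_k = 3^k x₀ + B_k one has
-- Y_{k+1} = 3 Y_k + 2^{b_k}; the hypothesis says 2^{b_n} x_n = Y_n, and since
-- 3 is odd this forces 2^{b_k} ∣ Y_k for all k ≤ n.  Hence X_k = Y_k / 2^{b_k}
-- are positive integers with 2^{a_{k+1}} X_{k+1} = 3 X_k + 1, they agree with
-- the rational iterates 'xs' of the statement, and telescoping gives the
-- product identity  Y_n · ∏_{k<n} 3X_k = 3^n x₀ · ∏_{k<n} (3X_k + 1),  i.e.
-- 1 + B_n/(3^n x₀) = ∏ (1 + 1/(3X_k))  and  2^{b_n} x_n/(3^n x₀) = the same.
--
-- The combinatorial heart is four estimates for ∏ (1 + 1/(3x)) over n
-- distinct positive integers x lying above, resp. below, a threshold.  They
-- are proved by one sweeping principle: move the threshold one step at a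
-- time, removing the threshold value from the list when it occurs.
--
-- Each part of the theorem is then a proof by contradiction: if no iterate
-- has the required property, all of X_0, …, X_{n-1} lie on one side of x₀
-- (resp. x_n), and the matching estimate, rescaled by the product identity,
-- contradicts the hypothesis on B_n.

open import Data.Empty using (⊥-elim)
open import Data.Integer.Base as ℤ using (ℤ; +_)
import Data.Integer.Properties as ℤ
open import Data.Integer.Tactic.RingSolver using () renaming (solve-∀ to solve-∀ℤ)
open import Data.List.Base using (List; []; _∷_; _++_; map; length; applyDownFrom)
open import Data.List.Properties using (length-applyDownFrom)
open import Data.List.Membership.Propositional.Properties using (∈-∃++)
open import Data.List.Relation.Binary.Permutation.Propositional using (_↭_; ↭⇒↭ₛ)
open import Data.List.Relation.Binary.Permutation.Propositional.Properties
  using (shift; ↭-length; All-resp-↭; map⁺)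
open import Data.List.Relation.Unary.All as All using (All; []; _∷_)
import Data.List.Relation.Unary.All.Properties as All
open import Data.List.Relation.Unary.AllPairs using (uncons)
open import Data.List.Relation.Unary.Unique.Propositional using (Unique)
import Data.List.Relation.Unary.Unique.Propositional.Properties as Unique
open import Data.Nat.Base
  using (ℕ; zero; suc; _+_; _*_; _^_; _∸_; _≤_; _<_; z≤n; s≤s; s≤s⁻¹; z<s; NonZero; >-nonZero; >-nonZero⁻¹)
open import Data.Nat.Divisibility
  using (_∣_; divides; ∣-refl; ∣-trans; 1∣_; ∣m+n∣m⇒∣n; m∣m*n; *-cancelˡ-∣; *-monoʳ-∣)
open import Data.Nat.DivMod using (_/_; n/1≡n; m*[n/m]≡n)
open import Data.Nat.ListAction using (sum; product)
open import Data.Nat.ListAction.Properties using (product-↭)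
open import Data.Nat.Properties
open import Data.Nat.Tactic.RingSolver using (solve-∀)
open import Data.List.Membership.DecPropositional _≟_ using (_∈?_)
open import Data.Product.Base using (∃-syntax; _×_; _,_)
open import Data.Rational.Base as ℚ using (ℚ; 1ℚ; toℚᵘ)
import Data.Rational.Properties as ℚ using (_≤?_)
open import Data.Rational.Properties
  using (toℚᵘ-fromℚᵘ; toℚᵘ-mono-≤; toℚᵘ-mono-<; toℚᵘ-cancel-≤; toℚᵘ-injective;
         toℚᵘ-homo-+; toℚᵘ-homo-*)
open import Data.Rational.Unnormalised.Base as ℚᵘ using (mkℚᵘ; *≡*; *≤*; *<*)
import Data.Rational.Unnormalised.Properties as ℚᵘ
open import Data.Sum.Base using (_⊎_; inj₁; inj₂)
open import Function.Base using (_∘_)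
open import Relation.Binary.PropositionalEquality
open import Data.List.Relation.Binary.Permutation.Setoid.Properties (setoid ℕ) using (Unique-resp-↭)
open import Relation.Nullary.Decidable using (yes; no; decidable-stable; _×-dec_)
open import Relation.Nullary.Negation using (¬_)
import Relation.Unary as U
open import Defs

-- For a list xs of positive integers, P xs / Q xs = ∏ (1 + 1/(3x)).
P Q : List ℕ → ℕ
P xs = product (map (λ x → 3 * x + 1) xs)
Q xs = product (map (3 *_) xs)

Q≤P : ∀ xs → Q xs ≤ P xs
Q≤P []       = ≤-refl
Q≤P (x ∷ xs) = *-mono-≤ (m≤m+n (3 * x) 1) (Q≤P xs)

P-pos : ∀ xs → 0 < P xs
P-pos []       = ≤-refl
P-pos (x ∷ xs) = *-mono-≤ (m≤n+m 1 (3 * x)) (P-pos xs)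

Q-pos : ∀ {xs} → All (0 <_) xs → 0 < Q xs
Q-pos []           = ≤-refl
Q-pos (x>0 ∷ x>0s) = *-mono-≤ (≤-trans (s≤s z≤n) (*-monoʳ-≤ 3 x>0)) (Q-pos x>0s)

-- Every entry of a list of naturals is at most its sum; this bounds the
-- number of steps of the upward sweep.
≤-sum : ∀ xs → All (_≤ sum xs) xs
≤-sum []       = []
≤-sum (x ∷ xs) = m≤m+n x (sum xs) ∷ All.map (λ y≤ → ≤-trans y≤ (m≤n+m (sum xs) x)) (≤-sum xs)

peel : ∀ v {xs} → Unique xs →
       All (v ≢_) xs ⊎ ∃[ ys ] (xs ↭ v ∷ ys × All (v ≢_) ys × Unique ys)
peel v {xs} u with v ∈? xs
... | no v∉xs = inj₁ (All.¬Any⇒All¬ xs v∉xs)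
... | yes v∈xs with ys , zs , refl ← ∈-∃++ v∈xs
  with v∉ys++zs , u′ ← uncons (Unique-resp-↭ (↭⇒↭ₛ (shift v ys zs)) u)
  = inj₂ (ys ++ zs , shift v ys zs , v∉ys++zs , u′)

-- Let Φ c n p q be an estimate about a duplicate-free
-- list with n entries and products p = P xs, q = Q xs whose entries all lie
-- on one side of the threshold c.  It is proved by moving the threshold one
-- step at a time: 'skip' when the next value v is not in the list, 'take'
-- when it is (v is then removed and contributes the factors 3v + 1 and 3v).
-- Since Φ only sees (n, P, Q), it is invariant under permutations.
module Sweep (Φ : ℕ → ℕ → ℕ → ℕ → Set) where

  Φ[_,_] : ℕ → List ℕ → Set
  Φ[ c , xs ] = Φ c (length xs) (P xs) (Q xs)

  Φ-resp-↭ : ∀ {c xs ys} → xs ↭ ys → Φ[ c , ys ] → Φ[ c , xs ]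
  Φ-resp-↭ σ φ rewrite ↭-length σ
                     | product-↭ (map⁺ (λ x → 3 * x + 1) σ)
                     | product-↭ (map⁺ (3 *_) σ) = φ

  module Up (empty : ∀ c → Φ[ c , [] ])
            (skip  : ∀ c xs → Φ[ suc c , xs ] → Φ[ c , xs ])
            (take  : ∀ c ys → Φ[ suc c , ys ] → Φ[ c , suc c ∷ ys ]) where

    private
      narrow : ∀ {c k xs} → All (λ x → c < x × x ≤ c + suc k) xs → All (suc c ≢_) xs →
               All (λ x → suc c < x × x ≤ suc c + k) xs
      narrow {c} {k} window v∉ = All.zipWith (λ ((c<x , x≤) , c+1≢x) →
        ≤∧≢⇒< c<x c+1≢x , ≤-trans x≤ (≤-reflexive (+-suc c k))) (window , v∉)

      sweep-within : ∀ k c {xs} → Unique xs → All (λ x → c < x × x ≤ c + k) xs → Φ[ c , xs ]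
      sweep-within zero    c {[]}    _ _                    = empty c
      sweep-within zero    c {_ ∷ _} _ ((c<x , x≤c+0) ∷ _) =
        ⊥-elim (<⇒≱ c<x (≤-trans x≤c+0 (≤-reflexive (+-identityʳ c))))
      sweep-within (suc k) c {xs} u window with peel (suc c) u
      ... | inj₁ v∉xs = skip c xs (sweep-within k (suc c) u (narrow window v∉xs))
      ... | inj₂ (ys , σ , v∉ys , u′) = Φ-resp-↭ σ (take c ys (sweep-within k (suc c) u′
              (narrow (All.tail (All-resp-↭ σ window)) v∉ys)))

    sweep : ∀ c {xs} → Unique xs → All (c <_) xs → Φ[ c , xs ]
    sweep c {xs} u above = sweep-within (sum xs) c u
      (All.zipWith (λ (c<x , x≤) → c<x , ≤-trans x≤ (m≤n+m (sum xs) c)) (above , ≤-sum xs))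

  module Down (empty : Φ[ 0 , [] ])
              (skip  : ∀ c xs → Φ[ c , xs ] → Φ[ suc c , xs ])
              (take  : ∀ c ys → Φ[ c , ys ] → Φ[ suc c , suc c ∷ ys ]) where

    private
      narrow : ∀ {c xs} → All (λ x → 0 < x × x ≤ suc c) xs → All (suc c ≢_) xs →
               All (λ x → 0 < x × x ≤ c) xs
      narrow window v∉ = All.zipWith (λ ((0<x , x≤) , c+1≢x) →
        0<x , s≤s⁻¹ (≤∧≢⇒< x≤ (c+1≢x ∘ sym))) (window , v∉)

    sweep : ∀ c {xs} → Unique xs → All (λ x → 0 < x × x ≤ c) xs → Φ[ c , xs ]
    sweep zero    {[]}    _ _                 = empty
    sweep zero    {_ ∷ _} _ ((0<x , x≤0) ∷ _) = ⊥-elim (<⇒≱ 0<x x≤0)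
    sweep (suc c) {xs} u window with peel (suc c) u
    ... | inj₁ v∉xs = skip c xs (sweep c u (narrow window v∉xs))
    ... | inj₂ (ys , σ , v∉ys , u′) = Φ-resp-↭ σ (take c ys (sweep c u′
            (narrow (All.tail (All-resp-↭ σ window)) v∉ys)))

-- For q ≤ p the quantity a·(p - q) grows with a (stated without
-- subtraction); this is what makes every 'skip' step work.
regroup : ∀ k a d q → k + (a + d) * q ≡ (k + a * q) + d * q
regroup = solve-∀

slide-up : ∀ {a b p q} k l → a ≤ b → q ≤ p → k + a * q ≤ l + a * p → k + b * q ≤ l + b * p
slide-up {a} {p = p} {q} k l a≤b q≤p h with d , refl ← m≤n⇒∃[o]m+o≡n a≤b = begin
  k + (a + d) * q     ≡⟨ regroup k a d q ⟩
  (k + a * q) + d * q ≤⟨ +-mono-≤ h (*-monoʳ-≤ d q≤p) ⟩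
  (l + a * p) + d * p ≡⟨ regroup l a d p ⟨
  l + (a + d) * p     ∎
  where open ≤-Reasoning

slide-down : ∀ {a b p q} k l → a ≤ b → q ≤ p → k + b * p ≤ l + b * q → k + a * p ≤ l + a * q
slide-down {a} {p = p} {q} k l a≤b q≤p h with d , refl ← m≤n⇒∃[o]m+o≡n a≤b =
  +-cancelʳ-≤ (d * p) _ _ (begin
    (k + a * p) + d * p ≡⟨ regroup k a d p ⟨
    k + (a + d) * p     ≤⟨ h ⟩
    l + (a + d) * q     ≡⟨ regroup l a d q ⟩
    (l + a * q) + d * q ≤⟨ +-monoʳ-≤ (l + a * q) (*-monoʳ-≤ d q≤p) ⟩
    (l + a * q) + d * p ∎)
  where open ≤-Reasoning

3c≤3[c+1] : ∀ c → 3 * c ≤ 3 * suc c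
3c≤3[c+1] c = *-monoʳ-≤ 3 (n≤1+n c)

3[c+1]+1≤3[c+2] : ∀ c → 3 * suc c + 1 ≤ 3 * suc (suc c)
3[c+1]+1≤3[c+2] c = ≤-trans (+-monoʳ-≤ (3 * suc c) (s≤s z≤n)) (≤-reflexive (+3 c))
  where
  +3 : ∀ c → 3 * suc c + 3 ≡ 3 * suc (suc c)
  +3 = solve-∀

-- In the 'take' steps of (a) and (c), with A = 3v for the taken value v, the
-- bound for v ∷ ys factors through the bound for ys.
take-identity : ∀ A n q → A * (n * q + (A + 1) * q) ≡ suc n * (A * q) + A * (A * q)
take-identity = solve-∀

suc≤ : ∀ k n {p} → 0 < p → suc n ≤ suc k * (suc n * p)
suc≤ k n {p} p>0 = ≤-trans (m≤m*n (suc n) p {{>-nonZero p>0}}) (m≤n*m (suc n * p) (suc k))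

-- (a) entries > c:  P/Q ≤ 1 + n/(3(c+1))
upper : ∀ c {xs} → Unique xs → All (c <_) xs →
        3 * suc c * P xs ≤ length xs * Q xs + 3 * suc c * Q xs
upper = Up.sweep (λ _ → ≤-refl) skip take
  where
  open Sweep (λ c n p q → 3 * suc c * p ≤ n * q + 3 * suc c * q)
  skip : ∀ c xs → Φ[ suc c , xs ] → Φ[ c , xs ]
  skip c xs = slide-down 0 (length xs * Q xs) (3c≤3[c+1] (suc c)) (Q≤P xs)
  take : ∀ c ys → Φ[ suc c , ys ] → Φ[ c , suc c ∷ ys ]
  take c ys h = begin
    A * ((A + 1) * P ys)                ≤⟨ *-monoʳ-≤ A inner ⟩
    A * (n * Q ys + (A + 1) * Q ys)     ≡⟨ take-identity A n (Q ys) ⟩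
    suc n * (A * Q ys) + A * (A * Q ys) ∎
    where
    open ≤-Reasoning
    A = 3 * suc c
    n = length ys
    inner : (A + 1) * P ys ≤ n * Q ys + (A + 1) * Q ys
    inner = slide-down 0 (n * Q ys) (3[c+1]+1≤3[c+2] c) (Q≤P ys) h

-- (b) entries > c, a strict refinement:  n + 3c·P ≤ n·P + 3c·Q,
-- i.e. 1 - Q/P < n/(3c) as soon as n ≥ 1.
upper-strict : ∀ c {xs} → Unique xs → All (c <_) xs →
               length xs + 3 * c * P xs ≤ length xs * P xs + 3 * c * Q xs
upper-strict = Up.sweep (λ _ → ≤-refl) skip take
  where
  open Sweep (λ c n p q → n + 3 * c * p ≤ n * p + 3 * c * q)
  skip : ∀ c xs → Φ[ suc c , xs ] → Φ[ c , xs ]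
  skip c xs = slide-down (length xs) (length xs * P xs) (3c≤3[c+1] c) (Q≤P xs)
  take : ∀ c ys → Φ[ suc c , ys ] → Φ[ c , suc c ∷ ys ]
  take c ys h = +-cancelʳ-≤ (C * (n * p)) _ _ (begin
    (suc n + C * ((A + 1) * p)) + C * (n * p)                      ≡⟨ e₁ c n p ⟩
    (suc n + C * p + C * (n * p)) + C * (A * p)                    ≤⟨ +-monoʳ-≤ _ (*-monoʳ-≤ C (m≤n+m (A * p) n)) ⟩
    (suc n + C * p + C * (n * p)) + C * (n + A * p)                ≤⟨ +-monoʳ-≤ _ (*-monoʳ-≤ C h) ⟩
    (suc n + C * p + C * (n * p)) + C * (n * p + A * q)            ≤⟨ +-monoˡ-≤ _ (+-monoˡ-≤ _ (+-monoˡ-≤ _ slack)) ⟩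
    (4 * (suc n * p) + C * p + C * (n * p)) + C * (n * p + A * q)  ≡⟨ e₂ c n p q ⟩
    (suc n * ((A + 1) * p) + C * (A * q)) + C * (n * p)            ∎)
    where
    open ≤-Reasoning
    C = 3 * c
    A = 3 * suc c
    n = length ys
    p = P ys
    q = Q ys
    slack : suc n ≤ 4 * (suc n * p)
    slack = suc≤ 3 n (P-pos ys)
    e₁ : ∀ c n p → (suc n + 3 * c * ((3 * suc c + 1) * p)) + 3 * c * (n * p)
                   ≡ (suc n + 3 * c * p + 3 * c * (n * p)) + 3 * c * (3 * suc c * p)
    e₁ = solve-∀
    e₂ : ∀ c n p q → (4 * (suc n * p) + 3 * c * p + 3 * c * (n * p)) + 3 * c * (n * p + 3 * suc c * q)
                     ≡ (suc n * ((3 * suc c + 1) * p) + 3 * c * (3 * suc c * q)) + 3 * c * (n * p)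
    e₂ = solve-∀

-- (c) entries in 1 … c:  1 + n/(3c) ≤ P/Q
lower : ∀ c {xs} → Unique xs → All (λ x → 0 < x × x ≤ c) xs →
        length xs * Q xs + 3 * c * Q xs ≤ 3 * c * P xs
lower = Down.sweep ≤-refl skip take
  where
  open Sweep (λ c n p q → n * q + 3 * c * q ≤ 3 * c * p)
  skip : ∀ c xs → Φ[ c , xs ] → Φ[ suc c , xs ]
  skip c xs = slide-up (length xs * Q xs) 0 (3c≤3[c+1] c) (Q≤P xs)
  take : ∀ c ys → Φ[ c , ys ] → Φ[ suc c , suc c ∷ ys ]
  take c ys h = begin
    suc n * (A * Q ys) + A * (A * Q ys) ≡⟨ take-identity A n (Q ys) ⟨
    A * (n * Q ys + (A + 1) * Q ys)     ≤⟨ *-monoʳ-≤ A (slide-up (n * Q ys) 0 3c≤A+1 (Q≤P ys) h) ⟩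
    A * ((A + 1) * P ys)                ∎
    where
    open ≤-Reasoning
    A = 3 * suc c
    n = length ys
    3c≤A+1 : 3 * c ≤ A + 1
    3c≤A+1 = ≤-trans (3c≤3[c+1] c) (m≤m+n A 1)

-- (d) entries in 1 … c, a strict refinement:  n·P + n + 3(c+1)·Q ≤ 3(c+1)·P,
-- i.e. n/(3(c+1)) < 1 - Q/P as soon as n ≥ 1.
lower-strict : ∀ c {xs} → Unique xs → All (λ x → 0 < x × x ≤ c) xs →
               length xs * P xs + length xs + 3 * suc c * Q xs ≤ 3 * suc c * P xs
lower-strict = Down.sweep ≤-refl skip take
  where
  open Sweep (λ c n p q → n * p + n + 3 * suc c * q ≤ 3 * suc c * p)
  skip : ∀ c xs → Φ[ c , xs ] → Φ[ suc c , xs ]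
  skip c xs = slide-up (length xs * P xs + length xs) 0 (3c≤3[c+1] (suc c)) (Q≤P xs)
  take : ∀ c ys → Φ[ c , ys ] → Φ[ suc c , suc c ∷ ys ]
  take c ys h = +-cancelʳ-≤ (A′ * (n * p + n)) _ _ (begin
    (N + suc n + A′ * (A * q)) + A′ * (n * p + n)   ≡⟨ e₁ c n p q ⟩
    (N + suc n) + A′ * (n * p + n + A * q)           ≤⟨ +-monoʳ-≤ (N + suc n) (*-monoʳ-≤ A′ h) ⟩
    (N + suc n) + A′ * (A * p)                       ≤⟨ +-monoˡ-≤ (A′ * (A * p)) (+-monoʳ-≤ N slack) ⟩
    (N + 2 * (suc n * p)) + A′ * (A * p)             ≤⟨ m≤m+n (N + 2 * (suc n * p) + A′ * (A * p)) (A′ * n) ⟩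
    (N + 2 * (suc n * p)) + A′ * (A * p) + A′ * n    ≡⟨ e₂ c n p ⟩
    A′ * ((A + 1) * p) + A′ * (n * p + n)            ∎)
    where
    open ≤-Reasoning
    A  = 3 * suc c
    A′ = 3 * suc (suc c)
    n  = length ys
    p  = P ys
    q  = Q ys
    N  = suc n * ((A + 1) * p)
    slack : suc n ≤ 2 * (suc n * p)
    slack = suc≤ 1 n (P-pos ys)
    e₁ : ∀ c n p q → (suc n * ((3 * suc c + 1) * p) + suc n + 3 * suc (suc c) * (3 * suc c * q))
                       + 3 * suc (suc c) * (n * p + n)
                     ≡ (suc n * ((3 * suc c + 1) * p) + suc n) + 3 * suc (suc c) * (n * p + n + 3 * suc c * q)
    e₁ = solve-∀
    e₂ : ∀ c n p → (suc n * ((3 * suc c + 1) * p) + 2 * (suc n * p)) + 3 * suc (suc c) * (3 * suc c * p)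
                     + 3 * suc (suc c) * n
                   ≡ 3 * suc (suc c) * ((3 * suc c + 1) * p) + 3 * suc (suc c) * (n * p + n)
    e₂ = solve-∀

toℚᵘ-/ : ∀ m q → toℚᵘ (+ m ℚ./ suc q) ℚᵘ.≃ mkℚᵘ (+ m) q
toℚᵘ-/ m q = toℚᵘ-fromℚᵘ (mkℚᵘ (+ m) q)

/-≤⇒ : ∀ m q r s .{{_ : NonZero q}} .{{_ : NonZero s}} →
       + m ℚ./ q ℚ.≤ + r ℚ./ s → m * s ≤ r * q
/-≤⇒ m (suc q) r (suc s) h
  with *≤* h′ ← ℚᵘ.≤-respʳ-≃ (toℚᵘ-/ r s) (ℚᵘ.≤-respˡ-≃ (toℚᵘ-/ m q) (toℚᵘ-mono-≤ h))
  = ℤ.drop‿+≤+ (subst₂ ℤ._≤_ (sym (ℤ.pos-* m (suc s))) (sym (ℤ.pos-* r (suc q))) h′)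

/-<⇒ : ∀ m q r s .{{_ : NonZero q}} .{{_ : NonZero s}} →
       + m ℚ./ q ℚ.< + r ℚ./ s → m * s < r * q
/-<⇒ m (suc q) r (suc s) h
  with *<* h′ ← ℚᵘ.<-respʳ-≃ (toℚᵘ-/ r s) (ℚᵘ.<-respˡ-≃ (toℚᵘ-/ m q) (toℚᵘ-mono-< h))
  = ℤ.drop‿+<+ (subst₂ ℤ._<_ (sym (ℤ.pos-* m (suc s))) (sym (ℤ.pos-* r (suc q))) h′)

ℕtoℚ-mono-≤ : ∀ {x y} → x ≤ y → ℕtoℚ x ℚ.≤ ℕtoℚ y
ℕtoℚ-mono-≤ {x} {y} x≤y = toℚᵘ-cancel-≤
  (ℚᵘ.≤-respˡ-≃ (ℚᵘ.≃-sym (toℚᵘ-/ x 0)) (ℚᵘ.≤-respʳ-≃ (ℚᵘ.≃-sym (toℚᵘ-/ y 0))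
    (*≤* (subst₂ ℤ._≤_ (ℤ.pos-* x 1) (ℤ.pos-* y 1) (ℤ.+≤+ (*-monoˡ-≤ 1 x≤y))))))

step-ℚ : ∀ x y N .{{_ : NonZero N}} → N * y ≡ 3 * x + 1 →
         (ℕtoℚ 3 ℚ.* ℕtoℚ x ℚ.+ 1ℚ) ℚ.* (+ 1 ℚ./ N) ≡ ℕtoℚ y
step-ℚ x y (suc N) N*y≡3x+1 = toℚᵘ-injective
  (ℚᵘ.≃-trans as-ℚᵘ (ℚᵘ.≃-trans exact (ℚᵘ.≃-sym (toℚᵘ-/ y 0))))
  where
  as-ℚᵘ : toℚᵘ ((ℕtoℚ 3 ℚ.* ℕtoℚ x ℚ.+ 1ℚ) ℚ.* (+ 1 ℚ./ suc N)) ℚᵘ.≃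
          (mkℚᵘ (+ 3) 0 ℚᵘ.* mkℚᵘ (+ x) 0 ℚᵘ.+ mkℚᵘ (+ 1) 0) ℚᵘ.* mkℚᵘ (+ 1) N
  as-ℚᵘ = ℚᵘ.≃-trans (toℚᵘ-homo-* (ℕtoℚ 3 ℚ.* ℕtoℚ x ℚ.+ 1ℚ) (+ 1 ℚ./ suc N)) (ℚᵘ.*-cong
            (ℚᵘ.≃-trans (toℚᵘ-homo-+ (ℕtoℚ 3 ℚ.* ℕtoℚ x) 1ℚ) (ℚᵘ.+-cong
              (ℚᵘ.≃-trans (toℚᵘ-homo-* (ℕtoℚ 3) (ℕtoℚ x)) (ℚᵘ.*-cong (toℚᵘ-/ 3 0) (toℚᵘ-/ x 0)))
              (toℚᵘ-/ 1 0)))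
            (toℚᵘ-/ 1 N))
  normalise : ∀ X → (((+ 3 ℤ.* X) ℤ.* + 1 ℤ.+ + 1 ℤ.* + 1) ℤ.* + 1) ℤ.* + 1 ≡ + 3 ℤ.* X ℤ.+ + 1
  normalise = solve-∀ℤ
  exact : (mkℚᵘ (+ 3) 0 ℚᵘ.* mkℚᵘ (+ x) 0 ℚᵘ.+ mkℚᵘ (+ 1) 0) ℚᵘ.* mkℚᵘ (+ 1) N ℚᵘ.≃ mkℚᵘ (+ y) 0
  exact = *≡* (begin
    _                      ≡⟨ normalise (+ x) ⟩
    + 3 ℤ.* + x ℤ.+ + 1    ≡⟨ cong (ℤ._+ + 1) (ℤ.pos-* 3 x) ⟨
    + (3 * x) ℤ.+ + 1      ≡⟨ ℤ.pos-+ (3 * x) 1 ⟨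
    + (3 * x + 1)          ≡⟨ cong +_ (trans (sym N*y≡3x+1) (*-comm (suc N) y)) ⟩
    + (y * suc N)          ≡⟨ ℤ.pos-* y (suc N) ⟩
    + y ℤ.* + suc N        ≡⟨ cong (λ k → + y ℤ.* + suc k) (+-identityʳ N) ⟨
    _                      ∎)
    where open ≡-Reasoning

sumTo-cong : ∀ k {f g : ℕ → ℕ} → (∀ i → i < k → f i ≡ g i) → sumTo k f ≡ sumTo k g
sumTo-cong zero    f≗g = refl
sumTo-cong (suc k) f≗g = cong₂ _+_ (sumTo-cong k (λ i i<k → f≗g i (m<n⇒m<1+n i<k))) (f≗g k ≤-refl)

sumTo-* : ∀ k c f → sumTo k (λ i → c * f i) ≡ c * sumTo k f
sumTo-* zero    c f = sym (*-zeroʳ c)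
sumTo-* (suc k) c f = trans (cong (_+ c * f k) (sumTo-* k c f)) (sym (*-distribˡ-+ c (sumTo k f) (f k)))

3^-pred : ∀ {k i} → i < k → 3 ^ (k ∸ i) ≡ 3 * 3 ^ (k ∸ 1 ∸ i)
3^-pred {suc k} (s≤s i≤k) = cong (3 ^_) (+-∸-assoc 1 i≤k)

B-suc : ∀ a k → B a (suc k) ≡ 3 * B a k + 2 ^ b a k
B-suc a k = cong₂ _+_
  (trans (sumTo-cong k one-more-3) (sumTo-* k 3 (λ i → 3 ^ (k ∸ 1 ∸ i) * 2 ^ b a i)))
  (trans (cong (λ e → 3 ^ e * 2 ^ b a k) (n∸n≡0 k)) (*-identityˡ (2 ^ b a k)))
  where
  one-more-3 : ∀ i → i < k → 3 ^ (k ∸ i) * 2 ^ b a i ≡ 3 * (3 ^ (k ∸ 1 ∸ i) * 2 ^ b a i)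
  one-more-3 i i<k = trans (cong (_* 2 ^ b a i) (3^-pred i<k)) (*-assoc 3 (3 ^ (k ∸ 1 ∸ i)) (2 ^ b a i))

pow2∣3* : ∀ e y → 2 ^ e ∣ 3 * y → 2 ^ e ∣ y
pow2∣3* zero    y _ = 1∣ y
pow2∣3* (suc e) y h = halve (∣m+n∣m⇒∣n (subst (2 ∣_) (3y≡2y+y y) (∣-trans (m∣m*n (2 ^ e)) h)) (m∣m*n y))
  where
  3y≡2y+y : ∀ y → 3 * y ≡ 2 * y + y
  3y≡2y+y = solve-∀
  3[2q]≡2[3q] : ∀ q → 3 * (q * 2) ≡ 2 * (3 * q)
  3[2q]≡2[3q] = solve-∀
  halve : 2 ∣ y → 2 ^ suc e ∣ y
  halve (divides q refl) = subst (2 ^ suc e ∣_) (*-comm 2 q)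
    (*-monoʳ-∣ 2 (pow2∣3* e q (*-cancelˡ-∣ 2 (subst (2 ^ suc e ∣_) (3[2q]≡2[3q] q) h))))

-- The orbit of x₀ under the exponents a: Y_k = 3^k x₀ + B_k and, as long as
-- 2^{b_k} ∣ Y_k, the iterate X_k = Y_k / 2^{b_k}.
module Orbit (a : ℕ → ℕ) (x₀ : ℕ) where

  Y : ℕ → ℕ
  Y k = 3 ^ k * x₀ + B a k

  Y-suc : ∀ k → Y (suc k) ≡ 3 * Y k + 2 ^ b a k
  Y-suc k = trans (cong (λ y → 3 * 3 ^ k * x₀ + y) (B-suc a k)) (regroup₃ (3 ^ k) x₀ (B a k) (2 ^ b a k))
    where
    regroup₃ : ∀ t x c w → 3 * t * x + (3 * c + w) ≡ 3 * (t * x + c) + w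
    regroup₃ = solve-∀

  ∣Y-pred : ∀ k → 2 ^ b a (suc k) ∣ Y (suc k) → 2 ^ b a k ∣ Y k
  ∣Y-pred k h = pow2∣3* (b a k) (Y k)
    (∣m+n∣m⇒∣n (subst (2 ^ b a k ∣_) Y[k+1]≡ (∣-trans 2^b∣2^b′ h)) ∣-refl)
    where
    Y[k+1]≡ : Y (suc k) ≡ 2 ^ b a k + 3 * Y k
    Y[k+1]≡ = trans (Y-suc k) (+-comm (3 * Y k) (2 ^ b a k))
    2^b∣2^b′ : 2 ^ b a k ∣ 2 ^ b a (suc k)
    2^b∣2^b′ = subst (2 ^ b a k ∣_) (sym (^-distribˡ-+-* 2 (b a k) (a (suc k)))) (m∣m*n (2 ^ a (suc k)))

  ∣Y-below : ∀ d k → 2 ^ b a (d + k) ∣ Y (d + k) → 2 ^ b a k ∣ Y k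
  ∣Y-below zero    k h = h
  ∣Y-below (suc d) k h = ∣Y-below d k (∣Y-pred (d + k) h)

  X : ℕ → ℕ
  X k = _/_ (Y k) (2 ^ b a k) {{m^n≢0 2 (b a k)}}

  X-zero : X 0 ≡ x₀
  X-zero = trans (n/1≡n (Y 0)) (trans (+-identityʳ (1 * x₀)) (*-identityˡ x₀))

  orbit : ℕ → List ℕ
  orbit = applyDownFrom X

  module Endpoint (n xₙ : ℕ) (endpoint : 2 ^ b a n * xₙ ≡ Y n) where

    Y≡ : ∀ {k} → k ≤ n → Y k ≡ 2 ^ b a k * X k
    Y≡ {k} k≤n = sym (m*[n/m]≡n {{m^n≢0 2 (b a k)}} (∣Y-below (n ∸ k) k 2^b∣Y))
      where
      2^b∣Y : 2 ^ b a (n ∸ k + k) ∣ Y (n ∸ k + k)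
      2^b∣Y rewrite m∸n+n≡m k≤n = divides xₙ (trans (sym endpoint) (*-comm (2 ^ b a n) xₙ))

    Y-suc≡ : ∀ {k} → suc k ≤ n → Y (suc k) ≡ 2 ^ b a k * (3 * X k + 1)
    Y-suc≡ {k} k<n = begin
      Y (suc k)                          ≡⟨ Y-suc k ⟩
      3 * Y k + 2 ^ b a k                ≡⟨ cong (λ y → 3 * y + 2 ^ b a k) (Y≡ (<⇒≤ k<n)) ⟩
      3 * (2 ^ b a k * X k) + 2 ^ b a k  ≡⟨ factor (2 ^ b a k) (X k) ⟩
      2 ^ b a k * (3 * X k + 1)          ∎
      where
      open ≡-Reasoning
      factor : ∀ w x → 3 * (w * x) + w ≡ w * (3 * x + 1)
      factor = solve-∀

    X-step : ∀ {k} → suc k ≤ n → 2 ^ a (suc k) * X (suc k) ≡ 3 * X k + 1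
    X-step {k} k<n = *-cancelˡ-≡ _ _ (2 ^ b a k) {{m^n≢0 2 (b a k)}} (begin
      2 ^ b a k * (2 ^ a (suc k) * X (suc k)) ≡⟨ *-assoc (2 ^ b a k) _ _ ⟨
      2 ^ b a k * 2 ^ a (suc k) * X (suc k)   ≡⟨ cong (_* X (suc k)) (^-distribˡ-+-* 2 (b a k) (a (suc k))) ⟨
      2 ^ b a (suc k) * X (suc k)             ≡⟨ Y≡ k<n ⟨
      Y (suc k)                               ≡⟨ Y-suc≡ k<n ⟩
      2 ^ b a k * (3 * X k + 1)               ∎)
      where open ≡-Reasoning

    X-pos : 0 < x₀ → ∀ {k} → k ≤ n → 0 < X k
    X-pos x₀>0 {k} k≤n = >-nonZero⁻¹ (X k) {{m*n≢0⇒n≢0 (2 ^ b a k) {{>-nonZero (subst (0 <_) (Y≡ k≤n) Y>0)}}}}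
      where
      Y>0 : 0 < Y k
      Y>0 = ≤-trans (*-mono-≤ (m^n>0 3 k) x₀>0) (m≤m+n (3 ^ k * x₀) (B a k))

    xs≡X : ∀ {k} → k ≤ n → xs a (+ x₀) k ≡ ℕtoℚ (X k)
    xs≡X {zero}  _   = cong ℕtoℚ (sym X-zero)
    xs≡X {suc k} k<n = trans
      (cong (λ x → (ℕtoℚ 3 ℚ.* x ℚ.+ 1ℚ) ℚ.* (1 /pow 2 ^ a (suc k))) (xs≡X (<⇒≤ k<n)))
      (step-ℚ (X k) (X (suc k)) (2 ^ a (suc k)) {{m^n≢0 2 (a (suc k))}} (X-step k<n))

    product-identity : ∀ {k} → k ≤ n → Y k * Q (orbit k) ≡ 3 ^ k * x₀ * P (orbit k)
    product-identity {zero}  _   = base x₀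
      where
      base : ∀ x → (1 * x + 0) * 1 ≡ 1 * x * 1
      base = solve-∀
    product-identity {suc k} k<n = begin
      Y (suc k) * (3 * X k * q)                      ≡⟨ cong (_* (3 * X k * q)) (Y-suc≡ k<n) ⟩
      2 ^ b a k * (3 * X k + 1) * (3 * X k * q)      ≡⟨ e₁ (2 ^ b a k) (X k) q ⟩
      3 * (3 * X k + 1) * ((2 ^ b a k * X k) * q)    ≡⟨ cong (λ y → 3 * (3 * X k + 1) * (y * q)) (Y≡ (<⇒≤ k<n)) ⟨
      3 * (3 * X k + 1) * (Y k * q)                  ≡⟨ cong (3 * (3 * X k + 1) *_) (product-identity (<⇒≤ k<n)) ⟩
      3 * (3 * X k + 1) * (3 ^ k * x₀ * P (orbit k)) ≡⟨ e₂ (X k) (3 ^ k) x₀ (P (orbit k)) ⟩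
      3 * 3 ^ k * x₀ * ((3 * X k + 1) * P (orbit k)) ∎
      where
      open ≡-Reasoning
      q = Q (orbit k)
      e₁ : ∀ w x q → w * (3 * x + 1) * (3 * x * q) ≡ 3 * (3 * x + 1) * ((w * x) * q)
      e₁ = solve-∀
      e₂ : ∀ x t y p → 3 * (3 * x + 1) * (t * y * p) ≡ 3 * t * y * ((3 * x + 1) * p)
      e₂ = solve-∀

transfer-≤ : ∀ t {x y c a b q} → 0 < q → t * x ≡ c + a * q → t * y ≡ c + b * q → x ≤ y → a ≤ b
transfer-≤ t {c = c} {a} {b} {q} q>0 ex ey x≤y = *-cancelʳ-≤ a b q {{>-nonZero q>0}}
  (+-cancelˡ-≤ c (a * q) (b * q) (subst₂ _≤_ ex ey (*-monoʳ-≤ t x≤y)))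

transfer-< : ∀ t {x y c a b q} → 0 < t → t * x ≡ c + a * q → t * y ≡ c + b * q → x < y → a < b
transfer-< t {c = c} {a} {b} {q} t>0 ex ey x<y = *-cancelʳ-< q a b
  (+-cancelˡ-< c (a * q) (b * q) (subst₂ _<_ ex ey (*-monoʳ-< t {{>-nonZero t>0}} x<y)))

-- Rescaling the estimates through the product identity (t·x₀ + β)·q = t·x₀·p
-- and the endpoint equation w·d = t·x₀ + β: multiplying by t, resp. by w,
-- brings both sides of an estimate to the form c + (…)·q, with β·3 on one
-- side and n·t, resp. n·w, on the other.
module Rescaling (t x₀ β p q w d : ℕ) (identity : (t * x₀ + β) * q ≡ t * x₀ * p)
                 (endpoint : w * d ≡ t * x₀ + β) where

  scale-P : t * (3 * x₀ * p) ≡ 3 * (t * x₀) * q + β * 3 * q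
  scale-P = begin
    t * (3 * x₀ * p)              ≡⟨ e₁ t x₀ p ⟩
    3 * (t * x₀ * p)              ≡⟨ cong (3 *_) identity ⟨
    3 * ((t * x₀ + β) * q)        ≡⟨ e₂ t x₀ β q ⟩
    3 * (t * x₀) * q + β * 3 * q  ∎
    where
    open ≡-Reasoning
    e₁ : ∀ t x p → t * (3 * x * p) ≡ 3 * (t * x * p)
    e₁ = solve-∀
    e₂ : ∀ t x β q → 3 * ((t * x + β) * q) ≡ 3 * (t * x) * q + β * 3 * q
    e₂ = solve-∀

  scale-Q : ∀ m → t * (m * q + 3 * x₀ * q) ≡ 3 * (t * x₀) * q + m * t * q
  scale-Q m = e t x₀ m q
    where
    e : ∀ t x m q → t * (m * q + 3 * x * q) ≡ 3 * (t * x) * q + m * t * q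
    e = solve-∀

  scale-P′ : w * (3 * d * p) ≡ 3 * (t * x₀) * p + β * 3 * p
  scale-P′ = begin
    w * (3 * d * p)               ≡⟨ e₁ w d p ⟩
    3 * ((w * d) * p)             ≡⟨ cong (λ y → 3 * (y * p)) endpoint ⟩
    3 * ((t * x₀ + β) * p)        ≡⟨ e₂ t x₀ β p ⟩
    3 * (t * x₀) * p + β * 3 * p  ∎
    where
    open ≡-Reasoning
    e₁ : ∀ w d p → w * (3 * d * p) ≡ 3 * ((w * d) * p)
    e₁ = solve-∀
    e₂ : ∀ t x β p → 3 * ((t * x + β) * p) ≡ 3 * (t * x) * p + β * 3 * p
    e₂ = solve-∀

  scale-Q′ : ∀ m → w * (m * p + 3 * d * q) ≡ 3 * (t * x₀) * p + m * w * p
  scale-Q′ m = begin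
    w * (m * p + 3 * d * q)             ≡⟨ e₁ w d m p q ⟩
    3 * ((w * d) * q) + m * w * p       ≡⟨ cong (λ y → 3 * (y * q) + m * w * p) endpoint ⟩
    3 * ((t * x₀ + β) * q) + m * w * p  ≡⟨ cong (λ y → 3 * y + m * w * p) identity ⟩
    3 * (t * x₀ * p) + m * w * p        ≡⟨ cong (_+ m * w * p) (e₂ t x₀ p) ⟩
    3 * (t * x₀) * p + m * w * p        ∎
    where
    open ≡-Reasoning
    e₁ : ∀ w d m p q → w * (m * p + 3 * d * q) ≡ 3 * ((w * d) * q) + m * w * p
    e₁ = solve-∀
    e₂ : ∀ t x p → 3 * (t * x * p) ≡ 3 * (t * x) * p
    e₂ = solve-∀

search : ∀ {P : ℕ → Set} → U.Decidable P → ∀ n → ¬ (∀ k → k < n → ¬ P k) → ∃[ k ] (k < n × P k)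
search P? n ¬none = decidable-stable (anyUpTo? P? n) λ ¬∃ → ¬none λ k k<n pk → ¬∃ (k , k<n , pk)

difference-ℕ : ∀ w d t x c → + w ℤ.* + d ℤ.- + t ℤ.* + x ≡ + c → w * d ≡ t * x + c
difference-ℕ w d t x c h = ℤ.+-injective (begin
  + (w * d)                                      ≡⟨ ℤ.pos-* w d ⟩
  + w ℤ.* + d                                    ≡⟨ split (+ w ℤ.* + d) (+ t ℤ.* + x) ⟩
  + t ℤ.* + x ℤ.+ (+ w ℤ.* + d ℤ.- + t ℤ.* + x)  ≡⟨ cong₂ ℤ._+_ (sym (ℤ.pos-* t x)) h ⟩
  + (t * x) ℤ.+ + c                              ≡⟨ ℤ.pos-+ (t * x) c ⟨
  + (t * x + c)                                  ∎)
  where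
  open ≡-Reasoning
  split : ∀ i j → i ≡ j ℤ.+ (i ℤ.- j)
  split = solve-∀ℤ

module Parts (a : ℕ → ℕ) (n′ c₀ d₀ : ℕ)
  (hyp : + (2 ^ b a (suc n′)) ℤ.* + suc d₀ ℤ.- + (3 ^ suc n′) ℤ.* + suc c₀ ≡ + (B a (suc n′)))
  (distinct : ∀ i j → i < j → j ≤ n′ → xs a (+ suc c₀) i ≢ xs a (+ suc c₀) j) where

  n x₀ xₙ : ℕ
  n  = suc n′
  x₀ = suc c₀
  xₙ = suc d₀

  endpoint : 2 ^ b a n * xₙ ≡ 3 ^ n * x₀ + B a n
  endpoint = difference-ℕ (2 ^ b a n) xₙ (3 ^ n) x₀ (B a n) hyp

  open Orbit a x₀
  open Endpoint n xₙ endpoint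

  instance
    3^n≢0 : NonZero (3 ^ n)
    3^n≢0 = m^n≢0 3 n
    2^bₙ≢0 : NonZero (2 ^ b a n)
    2^bₙ≢0 = m^n≢0 2 (b a n)

  x : ℕ → ℚ
  x = xs a (+ x₀)

  L : List ℕ
  L = orbit n

  unique : Unique L
  unique = Unique.applyDownFrom⁺₁ X n λ {i} {j} j<i i<n Xi≡Xj →
    distinct j i j<i (s≤s⁻¹ i<n) (trans (xs≡X (<⇒≤ (<-trans j<i i<n)))
                                  (trans (cong ℕtoℚ (sym Xi≡Xj)) (sym (xs≡X (<⇒≤ i<n)))))

  Q>0 : 0 < Q L
  Q>0 = Q-pos (All.applyDownFrom⁺₁ X n λ k<n → X-pos z<s (<⇒≤ k<n))

  len : length L ≡ n
  len = length-applyDownFrom X n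

  open Rescaling (3 ^ n) x₀ (B a n) (P L) (Q L) (2 ^ b a n) xₙ (product-identity ≤-refl) endpoint

  x≤ : ∀ {k y} → k ≤ n → X k ≤ y → x k ℚ.≤ ℕtoℚ y
  x≤ k≤n Xk≤y = subst (ℚ._≤ _) (sym (xs≡X k≤n)) (ℕtoℚ-mono-≤ Xk≤y)

  ≤x : ∀ {k y} → k ≤ n → y ≤ X k → ℕtoℚ y ℚ.≤ x k
  ≤x k≤n y≤Xk = subst (_ ℚ.≤_) (sym (xs≡X k≤n)) (ℕtoℚ-mono-≤ y≤Xk)

  -- (i): otherwise all X_k ≥ x₀, and (a) gives B_n·3 ≤ n·3^n.
  part-i : n /pow 3 ^ 1 ℚ.< B a n /pow 3 ^ n → ∃[ k ] (1 ≤ k × k ≤ n′ × x k ℚ.≤ x 0)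
  part-i h = let k , k<n , 1≤k , le = search (λ k → 1 ≤? k ×-dec x k ℚ.≤? x 0) n refute
             in k , 1≤k , s≤s⁻¹ k<n , le
    where
    refute : ¬ (∀ k → k < n → ¬ (1 ≤ k × x k ℚ.≤ x 0))
    refute none = <⇒≱ (/-<⇒ n 3 (B a n) (3 ^ n) h) (subst (λ m → B a n * 3 ≤ m * 3 ^ n) len
      (transfer-≤ (3 ^ n) Q>0 scale-P (scale-Q (length L)) (upper c₀ unique (All.applyDownFrom⁺₁ X n above))))
      where
      above : ∀ {k} → k < n → c₀ < X k
      above {zero}  _   = ≤-reflexive (sym X-zero)
      above {suc k} k<n = <⇒≤ (≰⇒> λ Xk≤x₀ → none (suc k) k<n (s≤s z≤n , x≤ (<⇒≤ k<n) Xk≤x₀))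

  -- (ii): otherwise all X_k ≤ x₀, and (c) gives n·3^n ≤ B_n·3.
  part-ii : B a n /pow 3 ^ n ℚ.< n /pow 3 ^ 1 → ∃[ k ] (1 ≤ k × k ≤ n′ × x 0 ℚ.≤ x k)
  part-ii h = let k , k<n , 1≤k , le = search (λ k → 1 ≤? k ×-dec x 0 ℚ.≤? x k) n refute
              in k , 1≤k , s≤s⁻¹ k<n , le
    where
    refute : ¬ (∀ k → k < n → ¬ (1 ≤ k × x 0 ℚ.≤ x k))
    refute none = <⇒≱ (/-<⇒ (B a n) (3 ^ n) n 3 h) (subst (λ m → m * 3 ^ n ≤ B a n * 3) len
      (transfer-≤ (3 ^ n) Q>0 (scale-Q (length L)) scale-P (lower x₀ unique (All.applyDownFrom⁺₁ X n below))))
      where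
      below : ∀ {k} → k < n → 0 < X k × X k ≤ x₀
      below {zero}  k<n = X-pos z<s (<⇒≤ k<n) , ≤-reflexive X-zero
      below {suc k} k<n = X-pos z<s (<⇒≤ k<n) ,
        <⇒≤ (≰⇒> λ x₀≤Xk → none (suc k) k<n (s≤s z≤n , ≤x (<⇒≤ k<n) x₀≤Xk))

  -- (iii): otherwise all X_i < xₙ, and (d) gives n·2^{b_n} < B_n·3.
  part-iii : B a n /pow 2 ^ b a n ℚ.≤ n /pow 3 ^ 1 → ∃[ i ] (i ≤ n′ × ℕtoℚ xₙ ℚ.≤ x i)
  part-iii h = let i , i<n , le = search (λ i → ℕtoℚ xₙ ℚ.≤? x i) n refute
               in i , s≤s⁻¹ i<n , le
    where
    refute : ¬ (∀ i → i < n → ¬ (ℕtoℚ xₙ ℚ.≤ x i))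
    refute none = <⇒≱ (subst (λ m → m * 2 ^ b a n < B a n * 3) len
      (transfer-< (2 ^ b a n) (m^n>0 2 (b a n)) (scale-Q′ (length L)) scale-P′ strict))
      (/-≤⇒ (B a n) (2 ^ b a n) n 3 h)
      where
      below : ∀ {i} → i < n → 0 < X i × X i ≤ d₀
      below {i} i<n = X-pos z<s (<⇒≤ i<n) , s≤s⁻¹ (≰⇒> λ xₙ≤Xi → none i i<n (≤x (<⇒≤ i<n) xₙ≤Xi))
      strict : length L * P L + 3 * xₙ * Q L < 3 * xₙ * P L
      strict = <-≤-trans (+-monoˡ-< (3 * xₙ * Q L) (m<m+n (length L * P L) z<s))
                         (lower-strict d₀ unique (All.applyDownFrom⁺₁ X n below))

  -- (iv): otherwise all X_k > xₙ, and (b) gives B_n·3 < n·2^{b_n}.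
  part-iv : n /pow 3 ^ 1 ℚ.≤ B a n /pow 2 ^ b a n → ∃[ k ] (k ≤ n′ × x k ℚ.≤ ℕtoℚ xₙ)
  part-iv h = let k , k<n , le = search (λ k → x k ℚ.≤? ℕtoℚ xₙ) n refute
              in k , s≤s⁻¹ k<n , le
    where
    refute : ¬ (∀ k → k < n → ¬ (x k ℚ.≤ ℕtoℚ xₙ))
    refute none = <⇒≱ (subst (λ m → B a n * 3 < m * 2 ^ b a n) len
      (transfer-< (2 ^ b a n) (m^n>0 2 (b a n)) scale-P′ (scale-Q′ (length L)) strict))
      (/-≤⇒ n 3 (B a n) (2 ^ b a n) h)
      where
      above : ∀ {k} → k < n → xₙ < X k
      above {k} k<n = ≰⇒> λ Xk≤xₙ → none k k<n (x≤ (<⇒≤ k<n) Xk≤xₙ)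
      strict : 3 * xₙ * P L < length L * P L + 3 * xₙ * Q L
      strict = <-≤-trans (m<n+m (3 * xₙ * P L) {length L} z<s)
                         (upper-strict xₙ unique (All.applyDownFrom⁺₁ X n above))

-- The theorem.
theorem4p10 : (a : ℕ → ℕ) → (∀ i → 1 ≤ i → 1 ≤ a i) →
    (n : ℕ) → 1 ≤ n →
    (x0 xn : ℤ) →
    (+ (2 ^ b a n)) ℤ.* xn ℤ.- (+ (3 ^ n)) ℤ.* x0 ≡ + (B a n) →
    + 1 ℤ.≤ x0 → x0 ℤ.< + (2 ^ b a n) →
    + 1 ℤ.≤ xn → xn ℤ.< + (3 ^ n) →
    (∀ i j → i < j → j ≤ n ∸ 1 → xs a x0 i ≢ xs a x0 j) →
    -- (i)
    ((n /pow 3 ^ 1) ℚ.< (B a n /pow 3 ^ n) →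
       ∃[ k ] (1 ≤ k × k ≤ n ∸ 1 × xs a x0 k ℚ.≤ xs a x0 0))
    ×
    -- (ii)
    ((B a n /pow 3 ^ n) ℚ.< (n /pow 3 ^ 1) →
       (∃[ k ] (1 ≤ k × k ≤ n ∸ 1 × xs a x0 0 ℚ.≤ xs a x0 k))
       ⊎ (ℤtoℚ x0 ℚ.≤ ℤtoℚ xn))
    ×
    -- (iii)
    ((B a n /pow 2 ^ b a n) ℚ.≤ (n /pow 3 ^ 1) →
       ∃[ i ] (i ≤ n ∸ 1 × ℤtoℚ xn ℚ.≤ xs a x0 i))
    ×
    -- (iv)
    ((n /pow 3 ^ 1) ℚ.≤ (B a n /pow 2 ^ b a n) →
       ∃[ k ] (k ≤ n ∸ 1 × xs a x0 k ℚ.≤ ℤtoℚ xn))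
theorem4p10 a _ (suc n′) _ (+ suc c₀) (+ suc d₀) hyp (ℤ.+≤+ (s≤s z≤n)) _ (ℤ.+≤+ (s≤s z≤n)) _ distinct =
  part-i , inj₁ ∘ part-ii , part-iii , part-iv
  where open Parts a n′ c₀ d₀ hyp distinct
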